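{- Let $P$ be a connected poset. The following are equivalent: (a) $\mathscr{D}(P)\cap \mathscr{U}(P)\neq\varnothing$; (b) $P$ has a maximum element and a minimum element; (c) $\mathscr{D}(P) = \mathscr{U}(P) = \{P\}$.
   Context: A subposet (subset) $S$ of a poset is connected if it is non-empty and connected with respect to the comparability relation (any two elements are joined by a finite sequence of elements of $S$ in which consecutive elements are comparable); its connected components are the maximal connected subsets. For a poset $P$, $\textup{mxl}(P)$ and $\textup{mnl}(P)$ denote the sets of maximal and minimal elements. For a non-empty $A\subseteq \textup{mxl}(P)$ let $L(A)=\{x\in P: x\le a \text{ for all } a\in A\}$, and for a non-empty $A\subseteq\textup{mnl}(P)$ let $U(A)=\{x\in P: x\ge a\text{ for all } a\in A\}$. $\mathscr{D}(P)$ is the set of all connected components of the non-empty sets $L(A)$, $A$ a non-empty subset of $\textup{mxl}(P)$, ordered by inclusion. $\mathscr{U}(P)$ is the set of all connected components of the non-empty sets $U(A)$, $A$ a non-empty subset of $\textup{mnl}(P)$, ordered by reverse inclusion. -}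

module Defs where

open import Level using (Level; _⊔_; suc)
open import Data.Product using (Σ; ∃; _×_; _,_)
open import Data.Sum using (_⊎_)
open import Data.Unit.Polymorphic using (⊤)
open import Relation.Binary.Bundles using (Poset)

module PosetDefs {c ℓ₁ ℓ₂ : Level} (P : Poset c ℓ₁ ℓ₂) where
  open Poset P public using (Carrier; _≈_; _≤_)

  ℓ : Level
  ℓ = c ⊔ ℓ₁ ⊔ ℓ₂

  Subset : Set (suc ℓ)
  Subset = Carrier → Set ℓ

  _⊆_ : Subset → Subset → Set ℓ
  S ⊆ T = ∀ x → S x → T x

  _≐_ : Subset → Subset → Set ℓ
  S ≐ T = (S ⊆ T) × (T ⊆ S)

  Full : Subset
  Full = λ _ → ⊤

  NonEmpty : Subset → Set ℓ
  NonEmpty S = ∃ λ x → S x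

  Comparable : Carrier → Carrier → Set ℓ₂
  Comparable x y = (x ≤ y) ⊎ (y ≤ x)

  data Path (S : Subset) : Carrier → Carrier → Set ℓ where
    here : ∀ {x} → S x → Path S x x
    step : ∀ {x y z} → S x → Comparable x y → Path S y z → Path S x z

  Connected : Subset → Set ℓ
  Connected S = NonEmpty S × (∀ x y → S x → S y → Path S x y)

  IsComponentOf : Subset → Subset → Set (suc ℓ)
  IsComponentOf S X =
    (S ⊆ X) × Connected S × (∀ (T : Subset) → Connected T → S ⊆ T → T ⊆ X → T ⊆ S)

  IsMaximal : Carrier → Set ℓ
  IsMaximal m = ∀ x → m ≤ x → x ≈ m

  IsMinimal : Carrier → Set ℓ
  IsMinimal m = ∀ x → x ≤ m → x ≈ m

  Lower : Subset → Subset
  Lower A x = ∀ a → A a → x ≤ a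

  Upper : Subset → Subset
  Upper A x = ∀ a → A a → a ≤ x

  -- membership in 𝒟(P): S is a connected component of the non-empty set L(A)
  -- for some non-empty A ⊆ mxl(P)
  InD : Subset → Set (suc ℓ)
  InD S = Σ Subset λ A →
    NonEmpty A × (∀ a → A a → IsMaximal a) × NonEmpty (Lower A) × IsComponentOf S (Lower A)

  -- membership in 𝒰(P) (as a set; the reverse-inclusion order is irrelevant here)
  InU : Subset → Set (suc ℓ)
  InU S = Σ Subset λ A →
    NonEmpty A × (∀ a → A a → IsMinimal a) × NonEmpty (Upper A) × IsComponentOf S (Upper A)

  CondA : Set (suc ℓ)
  CondA = Σ Subset λ S → InD S × InU S

  CondB : Set (c ⊔ ℓ₂)
  CondB = (∃ λ t → ∀ x → x ≤ t) × (∃ λ b → ∀ x → b ≤ x)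

  -- (c)  𝒟(P) = 𝒰(P) = {P}  (as sets of subsets, subsets up to extensional equality)
  CondC : Set (suc ℓ)
  CondC = (∀ S → (InD S → S ≐ Full) × (S ≐ Full → InD S))
        × (∀ S → (InU S → S ≐ Full) × (S ≐ Full → InU S))

-- A component S of both some L(A) and some U(B) absorbs every element comparable to one of
-- its own: adjoining ↓x (resp. ↑x) for x ∈ S keeps S connected and inside the down-closed
-- L(A) (resp. the up-closed U(B)), so by maximality ↓x, ↑x ⊆ S.  As P is connected, S = P,
-- hence every element of A is a maximum and every element of B a minimum.  Conversely, when P
-- has a maximum t, t is its only maximal element, so every L(A) is P itself and its only
-- component is P; dually for U.
module Submission where

open import Defs
open import Level using (Level; _⊔_; Lift; lift; lower)
open import Data.Product using (∃; _×_; _,_; proj₂)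
open import Data.Sum using (_⊎_; inj₁; inj₂)
open import Data.Unit.Polymorphic using (tt)
open import Relation.Binary.Bundles using (Poset)

module Development {c ℓ₁ ℓ₂ : Level} (P : Poset c ℓ₁ ℓ₂) where
  open PosetDefs P
  open Poset P using (refl; trans; antisym; reflexive; module Eq)

  _∪_ : Subset → Subset → Subset
  (S ∪ T) x = S x ⊎ T x

  ↑_ : Carrier → Subset
  (↑ x) y = Lift ℓ (x ≤ y)

  ↓_ : Carrier → Subset
  (↓ x) y = Lift ℓ (y ≤ x)

  UpClosed : Subset → Set ℓ
  UpClosed S = ∀ {x y} → S x → x ≤ y → S y

  DownClosed : Subset → Set ℓ
  DownClosed S = ∀ {x y} → S x → y ≤ x → S y

  ComparabilityClosed : Subset → Set ℓ
  ComparabilityClosed S = ∀ {x y} → S x → Comparable x y → S y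

  Maximum : Carrier → Set (c ⊔ ℓ₂)
  Maximum t = ∀ x → x ≤ t

  Minimum : Carrier → Set (c ⊔ ℓ₂)
  Minimum b = ∀ x → b ≤ x

  ≐-refl : ∀ {S} → S ≐ S
  ≐-refl = (λ _ s → s) , (λ _ s → s)

  Comparable-sym : ∀ {x y} → Comparable x y → Comparable y x
  Comparable-sym (inj₁ x≤y) = inj₂ x≤y
  Comparable-sym (inj₂ y≤x) = inj₁ y≤x

  Path-mono : ∀ {S T} → S ⊆ T → ∀ {x y} → Path S x y → Path T x y
  Path-mono S⊆T (here {x} s)       = here (S⊆T x s)
  Path-mono S⊆T (step {x} s xy p) = step (S⊆T x s) xy (Path-mono S⊆T p)

  _++_ : ∀ {S x y z} → Path S x y → Path S y z → Path S x z
  here _      ++ q = q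
  step s xy p ++ q = step s xy (p ++ q)

  Path-preserves : ∀ {S T} → ComparabilityClosed S → ∀ {x y} → Path T x y → S x → S y
  Path-preserves closed (here _)      sx = sx
  Path-preserves closed (step _ xy p) sx = Path-preserves closed p (closed sx xy)

  Connected-resp-≐ : ∀ {S T} → S ≐ T → Connected S → Connected T
  Connected-resp-≐ (S⊆T , T⊆S) ((x , sx) , paths) =
    (x , S⊆T x sx) , λ u v tu tv → Path-mono S⊆T (paths u v (T⊆S u tu) (T⊆S v tv))

  Connected-∪ : ∀ {S R x} → Connected S → S x → (∀ z → R z → Comparable x z) → Connected (S ∪ R)
  Connected-∪ {S} {R} {x} (_ , paths) sx comparable = (x , inj₁ sx) , λ u v su sv → to u su ++ from v sv
    where
    to : ∀ u → (S ∪ R) u → Path (S ∪ R) u x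
    to u (inj₁ su) = Path-mono (λ _ → inj₁) (paths u x su sx)
    to u (inj₂ ru) = step (inj₂ ru) (Comparable-sym (comparable u ru)) (here (inj₁ sx))

    from : ∀ v → (S ∪ R) v → Path (S ∪ R) x v
    from v (inj₁ sv) = Path-mono (λ _ → inj₁) (paths x v sx sv)
    from v (inj₂ rv) = step (inj₁ sx) (comparable v rv) (here (inj₂ rv))

  component-absorbs : ∀ {S X R x} → IsComponentOf S X → S x →
                      R ⊆ X → (∀ z → R z → Comparable x z) → R ⊆ S
  component-absorbs {S} {X} {R} (S⊆X , connS , maximal) sx R⊆X comparable z rz =
    maximal (S ∪ R) (Connected-∪ connS sx comparable) (λ _ → inj₁) S∪R⊆X z (inj₂ rz)
    where
    S∪R⊆X : (S ∪ R) ⊆ X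
    S∪R⊆X y (inj₁ sy) = S⊆X y sy
    S∪R⊆X y (inj₂ ry) = R⊆X y ry

  component-upClosed : ∀ {S X} → IsComponentOf S X → UpClosed X → UpClosed S
  component-upClosed comp@(S⊆X , _) upX {x} sx x≤y =
    component-absorbs {R = ↑ x} comp sx (λ z x≤z → upX (S⊆X x sx) (lower x≤z)) (λ _ x≤z → inj₁ (lower x≤z))
      _ (lift x≤y)

  component-downClosed : ∀ {S X} → IsComponentOf S X → DownClosed X → DownClosed S
  component-downClosed comp@(S⊆X , _) downX {x} sx y≤x =
    component-absorbs {R = ↓ x} comp sx (λ z z≤x → downX (S⊆X x sx) (lower z≤x)) (λ _ z≤x → inj₂ (lower z≤x))
      _ (lift y≤x)

  comparabilityClosed : ∀ {S} → UpClosed S → DownClosed S → ComparabilityClosed S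
  comparabilityClosed upS downS sx (inj₁ x≤y) = upS sx x≤y
  comparabilityClosed upS downS sx (inj₂ y≤x) = downS sx y≤x

  comparabilityClosed⇒⊇Full : ∀ {S} → Connected Full → NonEmpty S → ComparabilityClosed S → Full ⊆ S
  comparabilityClosed⇒⊇Full (_ , paths) (x , sx) closed y _ = Path-preserves closed (paths x y tt tt) sx

  component-⊇Full : ∀ {S X} → Connected Full → Full ⊆ X → S ≐ Full → IsComponentOf S X
  component-⊇Full connP Full⊆X (S⊆Full , Full⊆S) =
    (λ x sx → Full⊆X x (S⊆Full x sx)) , Connected-resp-≐ (Full⊆S , S⊆Full) connP
      , λ _ _ _ _ z _ → Full⊆S z tt

  Lower-downClosed : ∀ A → DownClosed (Lower A)
  Lower-downClosed A x≤A y≤x a Aa = trans y≤x (x≤A a Aa)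

  Upper-upClosed : ∀ A → UpClosed (Upper A)
  Upper-upClosed A A≤x x≤y a Aa = trans (A≤x a Aa) x≤y

  Lower-maximals : ∀ {t A} → Maximum t → (∀ a → A a → IsMaximal a) → Full ⊆ Lower A
  Lower-maximals {t} max maximals x _ a Aa = trans (max x) (reflexive (maximals a Aa t (max a)))

  Upper-minimals : ∀ {b A} → Minimum b → (∀ a → A a → IsMinimal a) → Full ⊆ Upper A
  Upper-minimals {b} min minimals x _ a Aa = trans (reflexive (Eq.sym (minimals a Aa b (min a)))) (min x)

  InD-⊇Full⇒maximum : ∀ {S} → InD S → Full ⊆ S → ∃ Maximum
  InD-⊇Full⇒maximum (A , (a , Aa) , _ , _ , S⊆L , _) Full⊆S = a , λ x → S⊆L x (Full⊆S x tt) a Aa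

  InU-⊇Full⇒minimum : ∀ {S} → InU S → Full ⊆ S → ∃ Minimum
  InU-⊇Full⇒minimum (B , (b , Bb) , _ , _ , S⊆U , _) Full⊆S = b , λ x → S⊆U x (Full⊆S x tt) b Bb

  module _ (connP : Connected Full) where

    InD∩InU⇒⊇Full : ∀ {S} → InD S → InU S → Full ⊆ S
    InD∩InU⇒⊇Full (A , _ , _ , _ , compL@(_ , (s , _) , _)) (B , _ , _ , _ , compU) =
      comparabilityClosed⇒⊇Full connP s (comparabilityClosed
        (component-upClosed compU (Upper-upClosed B))
        (component-downClosed compL (Lower-downClosed A)))

    module _ {t : Carrier} (max : Maximum t) where

      InD⇒≐Full : ∀ {S} → InD S → S ≐ Full
      InD⇒≐Full (A , _ , maximals , _ , _ , _ , maximal) =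
        (λ _ _ → tt) , maximal Full connP (λ _ _ → tt) (Lower-maximals max maximals)

      -- A = ↑t, which is {t} up to ≈ since t is the maximum.
      ≐Full⇒InD : ∀ {S} → S ≐ Full → InD S
      ≐Full⇒InD S≐Full =
        ↑ t , (t , lift refl) , maximals , (t , λ _ t≤a → lower t≤a)
          , component-⊇Full connP (Lower-maximals max maximals) S≐Full
        where
        maximals : ∀ a → (↑ t) a → IsMaximal a
        maximals a t≤a x a≤x = antisym (trans (max x) (lower t≤a)) a≤x

    module _ {b : Carrier} (min : Minimum b) where

      InU⇒≐Full : ∀ {S} → InU S → S ≐ Full
      InU⇒≐Full (B , _ , minimals , _ , _ , _ , maximal) =
        (λ _ _ → tt) , maximal Full connP (λ _ _ → tt) (Upper-minimals min minimals)

      ≐Full⇒InU : ∀ {S} → S ≐ Full → InU S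
      ≐Full⇒InU S≐Full =
        ↓ b , (b , lift refl) , minimals , (b , λ _ a≤b → lower a≤b)
          , component-⊇Full connP (Upper-minimals min minimals) S≐Full
        where
        minimals : ∀ a → (↓ b) a → IsMinimal a
        minimals a a≤b x x≤a = antisym x≤a (trans (lower a≤b) (min x))

    A⇒B : CondA → CondB
    A⇒B (S , inD , inU) =
      InD-⊇Full⇒maximum inD Full⊆S , InU-⊇Full⇒minimum inU Full⊆S
      where
      Full⊆S : Full ⊆ S
      Full⊆S = InD∩InU⇒⊇Full inD inU

    B⇒C : CondB → CondC
    B⇒C ((_ , max) , (_ , min)) =
      (λ _ → InD⇒≐Full max , ≐Full⇒InD max) , (λ _ → InU⇒≐Full min , ≐Full⇒InU min)

    C⇒B : CondC → CondB
    C⇒B (D-is-P , U-is-P) =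
      InD-⊇Full⇒maximum (proj₂ (D-is-P Full) ≐-refl) (λ _ _ → tt)
        , InU-⊇Full⇒minimum (proj₂ (U-is-P Full) ≐-refl) (λ _ _ → tt)

    C⇒A : CondC → CondA
    C⇒A (D-is-P , U-is-P) = Full , proj₂ (D-is-P Full) ≐-refl , proj₂ (U-is-P Full) ≐-refl

mainTheorem1 : {c ℓ₁ ℓ₂ : Level} (P : Poset c ℓ₁ ℓ₂) →
    let open PosetDefs P in
    Connected Full →
    ((CondA → CondB) × (CondB → CondA)) × ((CondB → CondC) × (CondC → CondB))
mainTheorem1 P connP = (A⇒B connP , λ b → C⇒A connP (B⇒C connP b)) , (B⇒C connP , C⇒B connP)
  where open Development P
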